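{- Let $r,n,p,q,k$ be non-negative integers with $p\geq n$. Then \[ \sum_{j=0}^{p}(-1)^{j}\binom{n+p+q+k+1}{p-j}\binom{q+j}{j}\binom{q+k+1+j}{k}\genfrac{[}{]}{0pt}{}{n+r+q+k+1+j}{r+q+k+1+j}_{r} =\binom{n+p+q+k+1}{n+k}\genfrac{[}{]}{0pt}{}{n+k+r}{k+r}_{r} \] and \[ \sum_{j=0}^{p}(-1)^{j}\binom{n+p+q+k+1}{p-j}\binom{q+j}{j}\binom{q+k+1+j}{k}\genfrac{\{}{\}}{0pt}{}{n+r+q+k+1+j}{r+q+k+1+j}_{r} =\binom{n+p+q+k+1}{n+k}\genfrac{\{}{\}}{0pt}{}{n+k+r}{k+r}_{r}. \]
   Context: For non-negative integers $r,k$, the $r$-Stirling numbers of the first and second kind are defined by $\sum_{n\ge k}\genfrac{[}{]}{0pt}{}{n+r}{k+r}_r\frac{t^n}{n!}=\frac{1}{k!}\frac{(-\ln(1-t))^k}{(1-t)^r}$ and $\sum_{n\ge k}\genfrac{\{}{\}}{0pt}{}{n+r}{k+r}_r\frac{t^n}{n!}=\frac{1}{k!}(e^t-1)^k e^{rt}$. -}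

module Defs where

open import Data.Nat using (ℕ; zero; suc; _+_; _*_; _∸_)
open import Data.Nat.Combinatorics using (_C_)
open import Data.Integer using (ℤ; +_; -_)
import Data.Integer as ℤ

-- rStirling1 r n k = [ n+r ; k+r ]_r  (unsigned r-Stirling numbers of the first kind)
-- EGF in n: (1/k!) (-ln(1-t))^k / (1-t)^r, equivalently the recurrence
--   [ n+1+r ; k+r ]_r = (n+r) [ n+r ; k+r ]_r + [ n+r ; k-1+r ]_r
rStirling1 : ℕ → ℕ → ℕ → ℕ
rStirling1 r zero    zero    = 1
rStirling1 r zero    (suc k) = 0
rStirling1 r (suc n) zero    = (n + r) * rStirling1 r n zero
rStirling1 r (suc n) (suc k) = (n + r) * rStirling1 r n (suc k) + rStirling1 r n k

-- rStirling2 r n k = { n+r ; k+r }_r  (r-Stirling numbers of the second kind)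
-- EGF in n: (1/k!) (e^t - 1)^k e^{rt}, equivalently the recurrence
--   { n+1+r ; k+r }_r = (k+r) { n+r ; k+r }_r + { n+r ; k-1+r }_r
rStirling2 : ℕ → ℕ → ℕ → ℕ
rStirling2 r zero    zero    = 1
rStirling2 r zero    (suc k) = 0
rStirling2 r (suc n) zero    = r * rStirling2 r n zero
rStirling2 r (suc n) (suc k) = (suc k + r) * rStirling2 r n (suc k) + rStirling2 r n k

sgn : ℕ → ℤ
sgn zero    = + 1
sgn (suc j) = - sgn j

sumTo : ℕ → (ℕ → ℤ) → ℤ
sumTo zero    f = f 0
sumTo (suc p) f = sumTo p f ℤ.+ f (suc p)

-- For N = n+p+q+k+1 and any polynomial P of degree < N, the N-th finite difference
-- Σ_{i ≤ N} (-1)^i C(N,i) P(i) vanishes. Take P(x) = C(x−n−k−1, q) C(x−n, k) G(x), where G is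
-- the n-th diagonal x ↦ S(x, x−n) of the Stirling triangle, extended by 0 below n. From the
-- triangle recurrence, Δ G_{n+1}(x) = (x + d_n) G_n(x) with d_n = r for the first kind and
-- d_n = r − n for the second, so G_n is a polynomial of degree 2n
-- (zeros below n included) and deg P = q + k + 2n < N because p ≥ n. For i ≤ n+q+k every
-- term vanishes except i = n+k, which gives the right-hand side; the terms i = n+q+k+1+j give
-- the left-hand side.
module Submission where

open import Defs
open import Data.Nat using (ℕ; zero; suc; _+_; _∸_; _≥_; _≤_; _<_; z≤n; s≤s)
import Data.Nat as ℕ
import Data.Nat.Properties as ℕP
open import Data.Nat.Combinatorics using (_C_; nCn≡1; nCk+nC[k+1]≡[n+1]C[k+1]; nCk≡nC[n∸k]; k>n⇒nCk≡0)
open import Data.Integer using (ℤ; +_; -_)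
import Data.Integer as ℤ
import Data.Integer.Properties as ℤP
open import Data.Integer.Tactic.RingSolver using (solve-∀)
import Data.Nat.Tactic.RingSolver as ℕSolver
open import Data.Product using (_×_; _,_)
open import Function using (_∘_)
open import Relation.Binary.PropositionalEquality
open import Relation.Nullary using (¬_; yes; no)
open import Data.Empty using (⊥-elim)

sumTo-cong : ∀ p {f g : ℕ → ℤ} → (∀ i → i ≤ p → f i ≡ g i) → sumTo p f ≡ sumTo p g
sumTo-cong zero    f≡g = f≡g 0 z≤n
sumTo-cong (suc p) f≡g =
  cong₂ ℤ._+_ (sumTo-cong p (λ i i≤p → f≡g i (ℕP.m≤n⇒m≤1+n i≤p))) (f≡g (suc p) ℕP.≤-refl)

sumTo-+ : ∀ p (f g : ℕ → ℤ) → sumTo p (λ i → f i ℤ.+ g i) ≡ sumTo p f ℤ.+ sumTo p g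
sumTo-+ zero    f g = refl
sumTo-+ (suc p) f g =
  trans (cong (ℤ._+ (f (suc p) ℤ.+ g (suc p))) (sumTo-+ p f g))
        (medial (sumTo p f) (sumTo p g) (f (suc p)) (g (suc p)))
  where
  medial : ∀ (a b c d : ℤ) → (a ℤ.+ b) ℤ.+ (c ℤ.+ d) ≡ (a ℤ.+ c) ℤ.+ (b ℤ.+ d)
  medial = solve-∀

sumTo-neg : ∀ p (f : ℕ → ℤ) → sumTo p (λ i → - f i) ≡ - sumTo p f
sumTo-neg zero    f = refl
sumTo-neg (suc p) f =
  trans (cong (ℤ._+ - f (suc p)) (sumTo-neg p f)) (sym (ℤP.neg-distrib-+ (sumTo p f) (f (suc p))))

sumTo-*ˡ : ∀ p (c : ℤ) (f : ℕ → ℤ) → sumTo p (λ i → c ℤ.* f i) ≡ c ℤ.* sumTo p f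
sumTo-*ˡ zero    c f = refl
sumTo-*ˡ (suc p) c f =
  trans (cong (ℤ._+ c ℤ.* f (suc p)) (sumTo-*ˡ p c f)) (sym (ℤP.*-distribˡ-+ c _ _))

sumTo-unconsˡ : ∀ p (f : ℕ → ℤ) → sumTo (suc p) f ≡ f 0 ℤ.+ sumTo p (f ∘ suc)
sumTo-unconsˡ zero    f = refl
sumTo-unconsˡ (suc p) f =
  trans (cong (ℤ._+ f (suc (suc p))) (sumTo-unconsˡ p f)) (ℤP.+-assoc (f 0) _ _)

sumTo-split : ∀ a b (f : ℕ → ℤ) →
  sumTo (suc (a + b)) f ≡ sumTo a f ℤ.+ sumTo b (λ j → f (suc (a + j)))
sumTo-split zero    b f = sumTo-unconsˡ b f
sumTo-split (suc a) b f = begin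
  sumTo (suc (suc a + b)) f                  ≡⟨ sumTo-unconsˡ (suc (a + b)) f ⟩
  f 0 ℤ.+ sumTo (suc (a + b)) (f ∘ suc)      ≡⟨ cong (λ s → f 0 ℤ.+ s) (sumTo-split a b (f ∘ suc)) ⟩
  f 0 ℤ.+ (sumTo a (f ∘ suc) ℤ.+ tail)       ≡⟨ ℤP.+-assoc (f 0) (sumTo a (f ∘ suc)) tail ⟨
  (f 0 ℤ.+ sumTo a (f ∘ suc)) ℤ.+ tail       ≡⟨ cong (ℤ._+ tail) (sumTo-unconsˡ a f) ⟨
  sumTo (suc a) f ℤ.+ tail                   ∎
  where
  open ≡-Reasoning
  tail : ℤ
  tail = sumTo b (λ j → f (suc (suc a + j)))

sumTo-zero : ∀ p (f : ℕ → ℤ) → (∀ i → i ≤ p → f i ≡ + 0) → sumTo p f ≡ + 0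
sumTo-zero p f f≡0 = trans (sumTo-cong p f≡0) (zeros p)
  where
  zeros : ∀ p → sumTo p (λ _ → + 0) ≡ + 0
  zeros zero    = refl
  zeros (suc p) = cong (ℤ._+ + 0) (zeros p)

sumTo-single : ∀ p t (f : ℕ → ℤ) → t ≤ p → (∀ i → i ≤ p → ¬ i ≡ t → f i ≡ + 0) → sumTo p f ≡ f t
sumTo-single zero    zero f z≤n _ = refl
sumTo-single (suc p) t f t≤p f≡0 with t ℕP.≟ suc p
... | yes refl = trans (cong (ℤ._+ f (suc p)) (sumTo-zero p f (λ i i≤p → f≡0 i (ℕP.m≤n⇒m≤1+n i≤p)
                                                                            (ℕP.<⇒≢ (s≤s i≤p)))))
                       (ℤP.+-identityˡ (f (suc p)))
... | no t≢1+p = trans (cong₂ ℤ._+_ (sumTo-single p t f t≤p′ (λ i i≤p → f≡0 i (ℕP.m≤n⇒m≤1+n i≤p)))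
                                    (f≡0 (suc p) ℕP.≤-refl (t≢1+p ∘ sym)))
                       (ℤP.+-identityʳ (f t))
  where
  t≤p′ : t ≤ p
  t≤p′ = ℕP.≤-pred (ℕP.≤∧≢⇒< t≤p t≢1+p)

sgn-+ : ∀ a b → sgn (a + b) ≡ sgn a ℤ.* sgn b
sgn-+ zero    b = sym (ℤP.*-identityˡ (sgn b))
sgn-+ (suc a) b = trans (cong -_ (sgn-+ a b)) (ℤP.neg-distribˡ-* (sgn a) (sgn b))

sgn-cancel : ∀ a {x y} → sgn a ℤ.* x ≡ sgn a ℤ.* y → x ≡ y
sgn-cancel zero    {x} {y} eq = trans (sym (ℤP.*-identityˡ x)) (trans eq (ℤP.*-identityˡ y))
sgn-cancel (suc a) {x} {y} eq = sgn-cancel a (ℤP.neg-injective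
  (trans (ℤP.neg-distribˡ-* (sgn a) x) (trans eq (sym (ℤP.neg-distribˡ-* (sgn a) y)))))

Δ : (ℕ → ℤ) → ℕ → ℤ
Δ f x = f (suc x) ℤ.- f x

Δ^ : ℕ → (ℕ → ℤ) → ℕ → ℤ
Δ^ zero    f = f
Δ^ (suc d) f = Δ^ d (Δ f)

Deg< : ℕ → (ℕ → ℤ) → Set
Deg< d f = ∀ x → Δ^ d f x ≡ + 0

Δ^-cong : ∀ d {f g : ℕ → ℤ} → (∀ x → f x ≡ g x) → ∀ x → Δ^ d f x ≡ Δ^ d g x
Δ^-cong zero    f≡g = f≡g
Δ^-cong (suc d) f≡g = Δ^-cong d (λ x → cong₂ ℤ._-_ (f≡g (suc x)) (f≡g x))

Deg<-cong : ∀ d {f g : ℕ → ℤ} → (∀ x → f x ≡ g x) → Deg< d f → Deg< d g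
Deg<-cong d f≡g df x = trans (sym (Δ^-cong d f≡g x)) (df x)

Deg<-+ : ∀ d {f g : ℕ → ℤ} → Deg< d f → Deg< d g → Deg< d (λ x → f x ℤ.+ g x)
Deg<-+ zero    df dg x = cong₂ ℤ._+_ (df x) (dg x)
Deg<-+ (suc d) {f} {g} df dg =
  Deg<-cong d (λ x → sym (Δ-+ (f (suc x)) (g (suc x)) (f x) (g x))) (Deg<-+ d df dg)
  where
  Δ-+ : ∀ (a b c d : ℤ) → (a ℤ.+ b) ℤ.- (c ℤ.+ d) ≡ (a ℤ.- c) ℤ.+ (b ℤ.- d)
  Δ-+ = solve-∀

Deg<-zero : ∀ d {f : ℕ → ℤ} → (∀ x → f x ≡ + 0) → Deg< d f
Deg<-zero zero    f≡0 = f≡0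
Deg<-zero (suc d) f≡0 = Deg<-zero d (λ x → cong₂ ℤ._-_ (f≡0 (suc x)) (f≡0 x))

Deg<-const : ∀ {f : ℕ → ℤ} c → (∀ x → f x ≡ c) → Deg< 1 f
Deg<-const c f≡c x = trans (cong₂ ℤ._-_ (f≡c (suc x)) (f≡c x)) (ℤP.+-inverseʳ c)

Deg<-affine : ∀ c → Deg< 2 (λ x → + x ℤ.+ c)
Deg<-affine c x = second-difference (+ x) c
  where
  -- + suc x is definitionally + 1 ℤ.+ + x, the form the ring solver can see.
  second-difference : ∀ (x c : ℤ) →
    (((+ 1 ℤ.+ (+ 1 ℤ.+ x)) ℤ.+ c) ℤ.- ((+ 1 ℤ.+ x) ℤ.+ c)) ℤ.- (((+ 1 ℤ.+ x) ℤ.+ c) ℤ.- (x ℤ.+ c)) ≡ + 0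
  second-difference = solve-∀

Deg<-mono : ∀ d e {f : ℕ → ℤ} → Deg< d f → Deg< (d + e) f
Deg<-mono zero    e df = Deg<-zero e df
Deg<-mono (suc d) e df = Deg<-mono d e df

Deg<-shift : ∀ d {f : ℕ → ℤ} → Deg< d f → Deg< d (f ∘ suc)
Deg<-shift zero    df x = df (suc x)
Deg<-shift (suc d) df   = Deg<-shift d df

Δ-* : ∀ (f g : ℕ → ℤ) x → Δ (λ y → f y ℤ.* g y) x ≡ Δ f x ℤ.* g (suc x) ℤ.+ f x ℤ.* Δ g x
Δ-* f g x = leibniz (f (suc x)) (f x) (g (suc x)) (g x)
  where
  leibniz : ∀ (f₁ f₀ g₁ g₀ : ℤ) → f₁ ℤ.* g₁ ℤ.- f₀ ℤ.* g₀ ≡ (f₁ ℤ.- f₀) ℤ.* g₁ ℤ.+ f₀ ℤ.* (g₁ ℤ.- g₀)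
  leibniz = solve-∀

mutual
  Deg<-* : ∀ a b {f g : ℕ → ℤ} → Deg< (suc a) f → Deg< (suc b) g →
    Deg< (suc (a + b)) (λ x → f x ℤ.* g x)
  Deg<-* a b {f} {g} df dg = Deg<-cong (a + b) (λ x → sym (Δ-* f g x))
    (Deg<-+ (a + b) (Deg<-*′ a b {Δ f} {g ∘ suc} df (Deg<-shift (suc b) {g} dg))
                    (Deg<-cong (a + b) (λ x → ℤP.*-comm (Δ g x) (f x))
                      (subst (λ d → Deg< d (λ x → Δ g x ℤ.* f x)) (ℕP.+-comm b a)
                             (Deg<-*′ b a {Δ g} {f} dg df))))

  Deg<-*′ : ∀ a b {f g : ℕ → ℤ} → Deg< a f → Deg< (suc b) g → Deg< (a + b) (λ x → f x ℤ.* g x)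
  Deg<-*′ zero    b {f} {g} df dg = Deg<-zero b (λ x → trans (cong (ℤ._* g x) (df x)) (ℤP.*-zeroˡ (g x)))
  Deg<-*′ (suc a) b {f} {g} df dg = Deg<-* a b {f} {g} df dg

alternating : ℕ → (ℕ → ℤ) → ℕ → ℤ
alternating N f x = sumTo N (λ i → sgn i ℤ.* + (N C i) ℤ.* f (x + i))

alternating-Δ : ∀ N f x → alternating N (Δ f) x ≡ alternating N f (suc x) ℤ.- alternating N f x
alternating-Δ N f x = begin
  alternating N (Δ f) x
    ≡⟨ sumTo-cong N (λ i _ → distrib (sgn i ℤ.* + (N C i)) (f (suc x + i)) (f (x + i))) ⟩
  sumTo N (λ i → sgn i ℤ.* + (N C i) ℤ.* f (suc x + i) ℤ.+ - (sgn i ℤ.* + (N C i) ℤ.* f (x + i)))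
    ≡⟨ sumTo-+ N _ _ ⟩
  alternating N f (suc x) ℤ.+ sumTo N (λ i → - (sgn i ℤ.* + (N C i) ℤ.* f (x + i)))
    ≡⟨ cong (λ s → alternating N f (suc x) ℤ.+ s) (sumTo-neg N _) ⟩
  alternating N f (suc x) ℤ.- alternating N f x ∎
  where
  open ≡-Reasoning
  distrib : ∀ (c u v : ℤ) → c ℤ.* (u ℤ.- v) ≡ c ℤ.* u ℤ.+ - (c ℤ.* v)
  distrib = solve-∀

alternating-suc : ∀ N f x → alternating (suc N) f x ≡ alternating N f x ℤ.- alternating N f (suc x)
alternating-suc N f x = begin
  alternating (suc N) f x
    ≡⟨ sumTo-unconsˡ N _ ⟩
  t 0 ℤ.+ sumTo N (λ i → sgn (suc i) ℤ.* + (suc N C suc i) ℤ.* f (x + suc i))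
    ≡⟨ cong (λ s → t 0 ℤ.+ s) (trans (sumTo-cong N (λ i _ → pascal i)) (sumTo-+ N _ _)) ⟩
  t 0 ℤ.+ (sumTo N (λ i → - t′ i) ℤ.+ sumTo N (t ∘ suc))
    ≡⟨ cong (λ s → t 0 ℤ.+ (s ℤ.+ sumTo N (t ∘ suc))) (trans (sumTo-neg N t′) (cong -_ shifted)) ⟩
  t 0 ℤ.+ (- alternating N f (suc x) ℤ.+ sumTo N (t ∘ suc))
    ≡⟨ rearrange (t 0) (alternating N f (suc x)) (sumTo N (t ∘ suc)) ⟩
  (t 0 ℤ.+ sumTo N (t ∘ suc)) ℤ.- alternating N f (suc x)
    ≡⟨ cong (ℤ._- alternating N f (suc x)) (sumTo-unconsˡ N t) ⟨
  (alternating N f x ℤ.+ t (suc N)) ℤ.- alternating N f (suc x)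
    ≡⟨ cong (λ s → (alternating N f x ℤ.+ s) ℤ.- alternating N f (suc x)) last-vanishes ⟩
  (alternating N f x ℤ.+ + 0) ℤ.- alternating N f (suc x)
    ≡⟨ cong (ℤ._- alternating N f (suc x)) (ℤP.+-identityʳ (alternating N f x)) ⟩
  alternating N f x ℤ.- alternating N f (suc x) ∎
  where
  open ≡-Reasoning
  t t′ : ℕ → ℤ
  t  i = sgn i ℤ.* + (N C i) ℤ.* f (x + i)
  t′ i = sgn i ℤ.* + (N C i) ℤ.* f (x + suc i)
  pascal : ∀ i → sgn (suc i) ℤ.* + (suc N C suc i) ℤ.* f (x + suc i) ≡ - t′ i ℤ.+ t (suc i)
  pascal i = trans
    (cong (λ c → - sgn i ℤ.* c ℤ.* f (x + suc i))
          (trans (cong +_ (sym (nCk+nC[k+1]≡[n+1]C[k+1] N i))) (ℤP.pos-+ (N C i) (N C suc i))))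
    (split-sum (sgn i) (+ (N C i)) (+ (N C suc i)) (f (x + suc i)))
    where
    split-sum : ∀ (s a b y : ℤ) → - s ℤ.* (a ℤ.+ b) ℤ.* y ≡ - (s ℤ.* a ℤ.* y) ℤ.+ - s ℤ.* b ℤ.* y
    split-sum = solve-∀
  shifted : sumTo N t′ ≡ alternating N f (suc x)
  shifted = sumTo-cong N (λ i _ → cong (λ y → sgn i ℤ.* + (N C i) ℤ.* f y) (ℕP.+-suc x i))
  last-vanishes : t (suc N) ≡ + 0
  last-vanishes = trans (cong (λ c → sgn (suc N) ℤ.* + c ℤ.* f (x + suc N)) (k>n⇒nCk≡0 (ℕP.n<1+n N)))
                        (annihilate (sgn (suc N)) (f (x + suc N)))
    where
    annihilate : ∀ (s y : ℤ) → s ℤ.* + 0 ℤ.* y ≡ + 0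
    annihilate = solve-∀
  rearrange : ∀ (a b c : ℤ) → a ℤ.+ (- b ℤ.+ c) ≡ (a ℤ.+ c) ℤ.- b
  rearrange = solve-∀

-- The N-th forward difference of f at x is (-1)^N times this alternating sum.
alternating-Deg< : ∀ N {f} → Deg< N f → ∀ x → alternating N f x ≡ + 0
alternating-Deg< zero    df x = cong (λ s → + 1 ℤ.* s) (df (x + 0))
alternating-Deg< (suc N) {f} df x = begin
  alternating (suc N) f x                        ≡⟨ alternating-suc N f x ⟩
  alternating N f x ℤ.- alternating N f (suc x)  ≡⟨ cong (λ s → alternating N f x ℤ.- s) constant ⟩
  alternating N f x ℤ.- alternating N f x        ≡⟨ ℤP.+-inverseʳ (alternating N f x) ⟩
  + 0                                            ∎
  where
  open ≡-Reasoning
  constant : alternating N f (suc x) ≡ alternating N f x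
  constant = ℤP.i-j≡0⇒i≡j _ _ (trans (sym (alternating-Δ N f x)) (alternating-Deg< N df x))

-- The polynomial x ↦ C(x − c, q); below c it takes the values C(−m, q) = (−1)^q C(m + q − 1, q).
shiftedChoose : ℕ → ℕ → ℕ → ℤ
shiftedChoose zero    q x       = + (x C q)
shiftedChoose (suc c) q zero    = sgn q ℤ.* + ((c + q) C q)
shiftedChoose (suc c) q (suc x) = shiftedChoose c q x

shiftedChoose-pascal : ∀ c q x →
  shiftedChoose c (suc q) (suc x) ≡ shiftedChoose c (suc q) x ℤ.+ shiftedChoose c q x
shiftedChoose-pascal zero q x = begin
  + (suc x C suc q)           ≡⟨ cong +_ (nCk+nC[k+1]≡[n+1]C[k+1] x q) ⟨
  + (x C q + x C suc q)       ≡⟨ cong +_ (ℕP.+-comm (x C q) (x C suc q)) ⟩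
  + (x C suc q + x C q)       ≡⟨ ℤP.pos-+ (x C suc q) (x C q) ⟩
  + (x C suc q) ℤ.+ + (x C q) ∎
  where open ≡-Reasoning
shiftedChoose-pascal (suc c) q (suc x) = shiftedChoose-pascal c q x
shiftedChoose-pascal (suc zero) q zero rewrite nCn≡1 (suc q) | nCn≡1 q = cancel (sgn q)
  where
  cancel : ∀ (s : ℤ) → + 0 ≡ - s ℤ.* + 1 ℤ.+ s ℤ.* + 1
  cancel = solve-∀
shiftedChoose-pascal (suc (suc c)) q zero = begin
  - sgn q ℤ.* + ((c + suc q) C suc q)
    ≡⟨ rearrange (sgn q) (+ ((c + suc q) C q)) (+ ((c + suc q) C suc q)) ⟩
  - sgn q ℤ.* (+ ((c + suc q) C q) ℤ.+ + ((c + suc q) C suc q)) ℤ.+ sgn q ℤ.* + ((c + suc q) C q)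
    ≡⟨ cong₂ (λ a b → - sgn q ℤ.* a ℤ.+ sgn q ℤ.* + (b C q))
             (trans (sym (ℤP.pos-+ ((c + suc q) C q) _)) (cong +_ (nCk+nC[k+1]≡[n+1]C[k+1] (c + suc q) q)))
             (ℕP.+-suc c q) ⟩
  - sgn q ℤ.* + (suc (c + suc q) C suc q) ℤ.+ sgn q ℤ.* + (suc (c + q) C q) ∎
  where
  open ≡-Reasoning
  rearrange : ∀ (s u v : ℤ) → - s ℤ.* v ≡ - s ℤ.* (u ℤ.+ v) ℤ.+ s ℤ.* u
  rearrange = solve-∀

shiftedChoose-zero : ∀ c x → shiftedChoose c 0 x ≡ + 1
shiftedChoose-zero zero    x       = refl
shiftedChoose-zero (suc c) zero    = refl
shiftedChoose-zero (suc c) (suc x) = shiftedChoose-zero c x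

shiftedChoose-Deg< : ∀ c q → Deg< (suc q) (shiftedChoose c q)
shiftedChoose-Deg< c zero    = Deg<-const (+ 1) (shiftedChoose-zero c)
shiftedChoose-Deg< c (suc q) = Deg<-cong (suc q) difference (shiftedChoose-Deg< c q)
  where
  difference : ∀ x → shiftedChoose c q x ≡ Δ (shiftedChoose c (suc q)) x
  difference x = trans (cancel (shiftedChoose c (suc q) x) (shiftedChoose c q x))
                       (cong (ℤ._- shiftedChoose c (suc q) x) (sym (shiftedChoose-pascal c q x)))
    where
    cancel : ∀ (a b : ℤ) → b ≡ (a ℤ.+ b) ℤ.- a
    cancel = solve-∀

shiftedChoose-+ : ∀ c q m → shiftedChoose c q (c + m) ≡ + (m C q)
shiftedChoose-+ zero    q m = refl
shiftedChoose-+ (suc c) q m = shiftedChoose-+ c q m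

shiftedChoose-vanishes : ∀ c q m → m < q → shiftedChoose c q (c + m) ≡ + 0
shiftedChoose-vanishes c q m m<q = trans (shiftedChoose-+ c q m) (cong +_ (k>n⇒nCk≡0 m<q))

shiftedChoose-pred : ∀ c q → shiftedChoose (suc c) q c ≡ sgn q
shiftedChoose-pred zero    q = trans (cong (λ b → sgn q ℤ.* + b) (nCn≡1 q)) (ℤP.*-identityʳ (sgn q))
shiftedChoose-pred (suc c) q = shiftedChoose-pred c q

data BelowOrFrom (n x : ℕ) : Set where
  below : x < n → BelowOrFrom n x
  from  : ∀ m → x ≡ n + m → BelowOrFrom n x

belowOrFrom : ∀ n x → BelowOrFrom n x
belowOrFrom zero    x    = from x refl
belowOrFrom (suc n) zero = below (s≤s z≤n)
belowOrFrom (suc n) (suc x) with belowOrFrom n x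
... | below x<n  = below (s≤s x<n)
... | from m x≡n+m = from m (cong suc x≡n+m)

diagonal : (ℕ → ℕ → ℕ) → ℕ → ℕ → ℤ
diagonal T zero    x       = + T x x
diagonal T (suc n) zero    = + 0
diagonal T (suc n) (suc x) = diagonal (λ a b → T (suc a) b) n x

diagonal-< : ∀ T n x → x < n → diagonal T n x ≡ + 0
diagonal-< T (suc n) zero    _         = refl
diagonal-< T (suc n) (suc x) (s≤s x<n) = diagonal-< (λ a b → T (suc a) b) n x x<n

diagonal-+ : ∀ T n m → diagonal T n (n + m) ≡ + T (n + m) m
diagonal-+ T zero    m = refl
diagonal-+ T (suc n) m = diagonal-+ (λ a b → T (suc a) b) n m

record StirlingRecurrence (T c : ℕ → ℕ → ℕ) : Set where
  field
    corner    : T 0 0 ≡ 1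
    top       : ∀ b → T 0 (suc b) ≡ 0
    step-zero : ∀ a → T (suc a) 0 ≡ c a 0 ℕ.* T a 0
    step-suc  : ∀ a b → T (suc a) (suc b) ≡ c a (suc b) ℕ.* T a (suc b) + T a b

  above : ∀ a b → a < b → T a b ≡ 0
  above zero    (suc b) _         = top b
  above (suc a) (suc b) (s≤s a<b) = begin
    T (suc a) (suc b)                          ≡⟨ step-suc a b ⟩
    c a (suc b) ℕ.* T a (suc b) + T a b        ≡⟨ cong₂ (λ u v → c a (suc b) ℕ.* u + v)
                                                        (above a (suc b) (ℕP.m<n⇒m<1+n a<b)) (above a b a<b) ⟩
    c a (suc b) ℕ.* 0 + 0                      ≡⟨ cong (_+ 0) (ℕP.*-zeroʳ (c a (suc b))) ⟩
    0                                          ∎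
    where open ≡-Reasoning

  diag : ∀ x → T x x ≡ 1
  diag zero    = corner
  diag (suc x) = begin
    T (suc x) (suc x)                          ≡⟨ step-suc x x ⟩
    c x (suc x) ℕ.* T x (suc x) + T x x        ≡⟨ cong₂ (λ u v → c x (suc x) ℕ.* u + v)
                                                        (above x (suc x) ℕP.≤-refl) (diag x) ⟩
    c x (suc x) ℕ.* 0 + 1                      ≡⟨ cong (_+ 1) (ℕP.*-zeroʳ (c x (suc x))) ⟩
    1                                          ∎
    where open ≡-Reasoning

  diagonal-Δ : ∀ (w : ℕ → ℕ → ℤ) → (∀ n m → w n (n + m) ≡ + c (n + m) m) →
    ∀ n x → Δ (diagonal T (suc n)) x ≡ w n x ℤ.* diagonal T n x
  diagonal-Δ w w≡c n x with belowOrFrom n x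
  ... | below x<n = begin
    diagonal T (suc n) (suc x) ℤ.- diagonal T (suc n) x  ≡⟨ cong₂ ℤ._-_ (diagonal-< T (suc n) (suc x) (s≤s x<n))
                                                                         (diagonal-< T (suc n) x (ℕP.m<n⇒m<1+n x<n)) ⟩
    + 0                                                  ≡⟨ ℤP.*-zeroʳ (w n x) ⟨
    w n x ℤ.* + 0                                        ≡⟨ cong (w n x ℤ.*_) (diagonal-< T n x x<n) ⟨
    w n x ℤ.* diagonal T n x                             ∎
    where open ≡-Reasoning
  ... | from zero refl = begin
    diagonal T (suc n) (suc (n + 0)) ℤ.- diagonal T (suc n) (n + 0)
      ≡⟨ cong₂ ℤ._-_ (diagonal-+ T (suc n) 0)
                     (diagonal-< T (suc n) (n + 0) (s≤s (ℕP.≤-reflexive (ℕP.+-identityʳ n)))) ⟩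
    + T (suc (n + 0)) 0 ℤ.- + 0
      ≡⟨ cong (λ t → + t ℤ.- + 0) (step-zero (n + 0)) ⟩
    + (c (n + 0) 0 ℕ.* T (n + 0) 0) ℤ.+ + 0
      ≡⟨ ℤP.+-identityʳ _ ⟩
    + (c (n + 0) 0 ℕ.* T (n + 0) 0)
      ≡⟨ ℤP.pos-* (c (n + 0) 0) (T (n + 0) 0) ⟩
    + c (n + 0) 0 ℤ.* + T (n + 0) 0
      ≡⟨ cong₂ ℤ._*_ (w≡c n 0) (diagonal-+ T n 0) ⟨
    w n (n + 0) ℤ.* diagonal T n (n + 0) ∎
    where open ≡-Reasoning
  ... | from (suc m) refl = begin
    diagonal T (suc n) (suc (n + suc m)) ℤ.- diagonal T (suc n) (n + suc m)
      ≡⟨ cong₂ ℤ._-_ (diagonal-+ T (suc n) (suc m)) lower-diagonal ⟩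
    + T (suc (n + suc m)) (suc m) ℤ.- + T (n + suc m) m
      ≡⟨ cong (λ t → + t ℤ.- + T (n + suc m) m) (step-suc (n + suc m) m) ⟩
    + (c (n + suc m) (suc m) ℕ.* T (n + suc m) (suc m) + T (n + suc m) m) ℤ.- + T (n + suc m) m
      ≡⟨ pos-+-cancelʳ (c (n + suc m) (suc m) ℕ.* T (n + suc m) (suc m)) (T (n + suc m) m) ⟩
    + (c (n + suc m) (suc m) ℕ.* T (n + suc m) (suc m))
      ≡⟨ ℤP.pos-* (c (n + suc m) (suc m)) (T (n + suc m) (suc m)) ⟩
    + c (n + suc m) (suc m) ℤ.* + T (n + suc m) (suc m)
      ≡⟨ cong₂ ℤ._*_ (w≡c n (suc m)) (diagonal-+ T n (suc m)) ⟨
    w n (n + suc m) ℤ.* diagonal T n (n + suc m) ∎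
    where
    open ≡-Reasoning
    lower-diagonal : diagonal T (suc n) (n + suc m) ≡ + T (n + suc m) m
    lower-diagonal = begin
      diagonal T (suc n) (n + suc m)  ≡⟨ cong (diagonal T (suc n)) (ℕP.+-suc n m) ⟩
      diagonal T (suc n) (suc n + m)  ≡⟨ diagonal-+ T (suc n) m ⟩
      + T (suc n + m) m               ≡⟨ cong (λ a → + T a m) (ℕP.+-suc n m) ⟨
      + T (n + suc m) m               ∎
    pos-+-cancelʳ : ∀ u v → + (u + v) ℤ.- + v ≡ + u
    pos-+-cancelʳ u v = trans (cong (ℤ._- + v) (ℤP.pos-+ u v)) (cancel (+ u) (+ v))
      where
      cancel : ∀ (u v : ℤ) → (u ℤ.+ v) ℤ.- v ≡ u
      cancel = solve-∀

  diagonal-Deg< : ∀ (d : ℕ → ℤ) → (∀ n m → + c (n + m) m ≡ + (n + m) ℤ.+ d n) →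
    ∀ n → Deg< (suc (n + n)) (diagonal T n)
  diagonal-Deg< d c-affine zero    = Deg<-const (+ 1) (λ x → cong +_ (diag x))
  diagonal-Deg< d c-affine (suc n) =
    subst (λ e → Deg< e (Δ (diagonal T (suc n)))) (cong suc (sym (ℕP.+-suc n n)))
      (Deg<-cong (suc (suc (n + n))) (λ x → sym (diagonal-Δ w (λ n m → sym (c-affine n m)) n x))
        (Deg<-* 1 (n + n) {w n} {diagonal T n} (Deg<-affine (d n)) (diagonal-Deg< d c-affine n)))
    where
    w : ℕ → ℕ → ℤ
    w n x = + x ℤ.+ d n

rStirling1-recurrence : ∀ r → StirlingRecurrence (rStirling1 r) (λ a _ → a + r)
rStirling1-recurrence r = record
  { corner = refl ; top = λ _ → refl ; step-zero = λ _ → refl ; step-suc = λ _ _ → refl }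

rStirling2-recurrence : ∀ r → StirlingRecurrence (rStirling2 r) (λ _ b → b + r)
rStirling2-recurrence r = record
  { corner = refl ; top = λ _ → refl ; step-zero = λ _ → refl ; step-suc = λ _ _ → refl }

module _ (n p q k : ℕ) (G : ℕ → ℤ) where

  private
    N a : ℕ
    N = n + p + q + k + 1
    a = n + q + k

    P : ℕ → ℤ
    P x = shiftedChoose (suc (n + k)) q x ℤ.* shiftedChoose n k x ℤ.* G x

    term : ℕ → ℤ
    term i = sgn i ℤ.* + (N C i) ℤ.* P i

    summand : ℕ → ℤ
    summand j = sgn j ℤ.* (+ (N C (p ∸ j)) ℤ.* + ((q + j) C j) ℤ.* + ((q + k + 1 + j) C k)
                             ℤ.* G (n + (q + k + 1 + j)))

    N≡1+a+p : N ≡ suc (a + p)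
    N≡1+a+p = reorder n p q k
      where
      reorder : ∀ n p q k → n + p + q + k + 1 ≡ suc (n + q + k + p)
      reorder = ℕSolver.solve-∀

  P-Deg< : n ≤ p → Deg< (suc (n + n)) G → Deg< N P
  P-Deg< n≤p dG = subst (λ e → Deg< e P) degree (Deg<-mono (suc (q + k + (n + n))) (p ∸ n) {P} dP)
    where
    dP : Deg< (suc (q + k + (n + n))) P
    dP = Deg<-* (q + k) (n + n) {λ x → shiftedChoose (suc (n + k)) q x ℤ.* shiftedChoose n k x} {G}
           (Deg<-* q k {shiftedChoose (suc (n + k)) q} {shiftedChoose n k}
                   (shiftedChoose-Deg< (suc (n + k)) q) (shiftedChoose-Deg< n k))
           dG
    degree : suc (q + k + (n + n)) + (p ∸ n) ≡ N
    reorder : ∀ n e q k → suc (q + k + (n + n)) + e ≡ n + (n + e) + q + k + 1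
    reorder = ℕSolver.solve-∀
    degree = trans (reorder n (p ∸ n) q k) (cong (λ m → n + m + q + k + 1) (ℕP.m+[n∸m]≡n n≤p))

  P-vanishes : (∀ x → x < n → G x ≡ + 0) → ∀ i → i ≤ a → ¬ i ≡ n + k → P i ≡ + 0
  P-vanishes G<n i i≤a i≢n+k with belowOrFrom n i
  ... | below i<n = trans (cong (λ g → shiftedChoose (suc (n + k)) q i ℤ.* shiftedChoose n k i ℤ.* g)
                                (G<n i i<n))
                          (ℤP.*-zeroʳ (shiftedChoose (suc (n + k)) q i ℤ.* shiftedChoose n k i))
  ... | from m refl with belowOrFrom k m
  ...   | below m<k = trans (cong (λ h → shiftedChoose (suc (n + k)) q (n + m) ℤ.* h ℤ.* G (n + m))
                                  (shiftedChoose-vanishes n k m m<k))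
                            (middle-zero (shiftedChoose (suc (n + k)) q (n + m)) (G (n + m)))
    where
    middle-zero : ∀ (u v : ℤ) → u ℤ.* + 0 ℤ.* v ≡ + 0
    middle-zero = solve-∀
  ...   | from zero refl = ⊥-elim (i≢n+k (cong (λ m → n + m) (ℕP.+-identityʳ k)))
  ...   | from (suc t) refl = trans (cong (λ h → h ℤ.* shiftedChoose n k i ℤ.* G i)
                                      (trans (cong (shiftedChoose (suc (n + k)) q) (shift n k t))
                                             (shiftedChoose-vanishes (suc (n + k)) q t t<q)))
                                (left-zero (shiftedChoose n k i) (G i))
    where
    left-zero : ∀ (u v : ℤ) → + 0 ℤ.* u ℤ.* v ≡ + 0
    left-zero = solve-∀
    shift : ∀ n k t → n + (k + suc t) ≡ suc (n + k) + t
    shift = ℕSolver.solve-∀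
    regroupˡ : ∀ n k t → n + (k + suc t) ≡ (n + k) + suc t
    regroupˡ = ℕSolver.solve-∀
    regroupʳ : ∀ n q k → n + q + k ≡ (n + k) + q
    regroupʳ = ℕSolver.solve-∀
    t<q : t < q
    t<q = ℕP.+-cancelˡ-≤ (n + k) (suc t) q (subst₂ _≤_ (regroupˡ n k t) (regroupʳ n q k) i≤a)

  lower-sum : (∀ x → x < n → G x ≡ + 0) → sumTo a term ≡ sgn a ℤ.* (+ (N C (n + k)) ℤ.* G (n + k))
  lower-sum G<n = trans (sumTo-single a (n + k) term n+k≤a term-vanishes) term-at-n+k
    where
    swap : ∀ n k q → n + k + q ≡ n + q + k
    swap = ℕSolver.solve-∀
    n+k≤a : n + k ≤ a
    n+k≤a = subst (n + k ≤_) (swap n k q) (ℕP.m≤m+n (n + k) q)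
    term-vanishes : ∀ i → i ≤ a → ¬ i ≡ n + k → term i ≡ + 0
    term-vanishes i i≤a i≢n+k = trans (cong (λ v → sgn i ℤ.* + (N C i) ℤ.* v) (P-vanishes G<n i i≤a i≢n+k))
                                      (ℤP.*-zeroʳ (sgn i ℤ.* + (N C i)))
    term-at-n+k : term (n + k) ≡ sgn a ℤ.* (+ (N C (n + k)) ℤ.* G (n + k))
    term-at-n+k = begin
      sgn (n + k) ℤ.* + (N C (n + k)) ℤ.* P (n + k)
        ≡⟨ cong₂ (λ u v → sgn (n + k) ℤ.* + (N C (n + k)) ℤ.* (u ℤ.* v ℤ.* G (n + k)))
                 (shiftedChoose-pred (n + k) q) (trans (shiftedChoose-+ n k k) (cong +_ (nCn≡1 k))) ⟩
      sgn (n + k) ℤ.* + (N C (n + k)) ℤ.* (sgn q ℤ.* + 1 ℤ.* G (n + k))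
        ≡⟨ regroup (sgn (n + k)) (sgn q) (+ (N C (n + k))) (G (n + k)) ⟩
      (sgn (n + k) ℤ.* sgn q) ℤ.* (+ (N C (n + k)) ℤ.* G (n + k))
        ≡⟨ cong (ℤ._* (+ (N C (n + k)) ℤ.* G (n + k)))
                (trans (sym (sgn-+ (n + k) q)) (cong sgn (swap n k q))) ⟩
      sgn a ℤ.* (+ (N C (n + k)) ℤ.* G (n + k)) ∎
      where
      open ≡-Reasoning
      regroup : ∀ (s t c g : ℤ) → s ℤ.* c ℤ.* (t ℤ.* + 1 ℤ.* g) ≡ (s ℤ.* t) ℤ.* (c ℤ.* g)
      regroup = solve-∀

  upper-term : ∀ j → j ≤ p → term (suc (a + j)) ≡ - (sgn a ℤ.* summand j)
  upper-term j j≤p = begin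
    sgn (suc (a + j)) ℤ.* + (N C suc (a + j)) ℤ.* P (suc (a + j))
      ≡⟨ cong₂ (λ s c → s ℤ.* + c ℤ.* P (suc (a + j))) (cong -_ (sgn-+ a j)) choose-N ⟩
    - (sgn a ℤ.* sgn j) ℤ.* + (N C (p ∸ j)) ℤ.* P (suc (a + j))
      ≡⟨ cong (λ v → - (sgn a ℤ.* sgn j) ℤ.* + (N C (p ∸ j)) ℤ.* v)
              (cong₂ ℤ._*_ (cong₂ ℤ._*_ choose-q choose-k) (cong G (index-k n q k j))) ⟩
    - (sgn a ℤ.* sgn j) ℤ.* + (N C (p ∸ j)) ℤ.* (+ C₂ ℤ.* + C₃ ℤ.* G (n + (q + k + 1 + j)))
      ≡⟨ regroup (sgn a) (sgn j) (+ (N C (p ∸ j))) (+ C₂) (+ C₃) (G (n + (q + k + 1 + j))) ⟩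
    - (sgn a ℤ.* summand j) ∎
    where
    open ≡-Reasoning
    C₂ C₃ : ℕ
    C₂ = (q + j) C j
    C₃ = (q + k + 1 + j) C k
    regroup : ∀ (s t c₁ c₂ c₃ g : ℤ) →
      - (s ℤ.* t) ℤ.* c₁ ℤ.* (c₂ ℤ.* c₃ ℤ.* g) ≡ - (s ℤ.* (t ℤ.* (c₁ ℤ.* c₂ ℤ.* c₃ ℤ.* g)))
    regroup = solve-∀
    index-q : ∀ n q k j → suc (n + q + k + j) ≡ suc (n + k) + (q + j)
    index-q = ℕSolver.solve-∀
    index-k : ∀ n q k j → suc (n + q + k + j) ≡ n + (q + k + 1 + j)
    index-k = ℕSolver.solve-∀
    choose-N : N C suc (a + j) ≡ N C (p ∸ j)
    choose-N = begin
      N C suc (a + j)                   ≡⟨ cong (_C suc (a + j)) N≡1+a+p ⟩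
      suc (a + p) C suc (a + j)         ≡⟨ nCk≡nC[n∸k] (s≤s (ℕP.+-monoʳ-≤ a j≤p)) ⟩
      suc (a + p) C ((a + p) ∸ (a + j)) ≡⟨ cong (suc (a + p) C_) (ℕP.[m+n]∸[m+o]≡n∸o a p j) ⟩
      suc (a + p) C (p ∸ j)             ≡⟨ cong (_C (p ∸ j)) N≡1+a+p ⟨
      N C (p ∸ j)                       ∎
    choose-q : shiftedChoose (suc (n + k)) q (suc (a + j)) ≡ + C₂
    choose-q = begin
      shiftedChoose (suc (n + k)) q (suc (a + j))         ≡⟨ cong (shiftedChoose (suc (n + k)) q) (index-q n q k j) ⟩
      shiftedChoose (suc (n + k)) q (suc (n + k) + (q + j)) ≡⟨ shiftedChoose-+ (suc (n + k)) q (q + j) ⟩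
      + ((q + j) C q)                                     ≡⟨ cong +_ (nCk≡nC[n∸k] (ℕP.m≤m+n q j)) ⟩
      + ((q + j) C ((q + j) ∸ q))                         ≡⟨ cong (λ i → + ((q + j) C i)) (ℕP.m+n∸m≡n q j) ⟩
      + ((q + j) C j)                                     ∎
    choose-k : shiftedChoose n k (suc (a + j)) ≡ + C₃
    choose-k = trans (cong (shiftedChoose n k) (index-k n q k j)) (shiftedChoose-+ n k (q + k + 1 + j))

  polynomial-identity : n ≤ p → (∀ x → x < n → G x ≡ + 0) → Deg< (suc (n + n)) G →
    sumTo p (λ j → sgn j ℤ.* (+ ((n + p + q + k + 1) C (p ∸ j)) ℤ.* + ((q + j) C j) ℤ.* + ((q + k + 1 + j) C k)
                               ℤ.* G (n + (q + k + 1 + j))))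
      ≡ + ((n + p + q + k + 1) C (n + k)) ℤ.* G (n + k)
  polynomial-identity n≤p G<n dG = sym (sgn-cancel a (ℤP.i-j≡0⇒i≡j _ _ (begin
    sgn a ℤ.* (+ (N C (n + k)) ℤ.* G (n + k)) ℤ.- sgn a ℤ.* sumTo p summand
      ≡⟨ cong₂ ℤ._+_ (lower-sum G<n) upper-sum ⟨
    sumTo a term ℤ.+ sumTo p (λ j → term (suc (a + j)))
      ≡⟨ sumTo-split a p term ⟨
    sumTo (suc (a + p)) term
      ≡⟨ cong (λ m → sumTo m term) N≡1+a+p ⟨
    alternating N P 0
      ≡⟨ alternating-Deg< N (P-Deg< n≤p dG) 0 ⟩
    + 0 ∎)))
    where
    open ≡-Reasoning
    upper-sum : sumTo p (λ j → term (suc (a + j))) ≡ - (sgn a ℤ.* sumTo p summand)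
    upper-sum = trans (sumTo-cong p upper-term)
                      (trans (sumTo-neg p (λ j → sgn a ℤ.* summand j)) (cong -_ (sumTo-*ˡ p (sgn a) summand)))

stirling-identity : ∀ {T c} → StirlingRecurrence T c →
  (d : ℕ → ℤ) → (∀ n m → + c (n + m) m ≡ + (n + m) ℤ.+ d n) →
  ∀ n p q k → n ≤ p →
  sumTo p (λ j → sgn j ℤ.* + (((n + p + q + k + 1) C (p ∸ j)) ℕ.* ((q + j) C j) ℕ.* ((q + k + 1 + j) C k)
                               ℕ.* T (n + q + k + 1 + j) (q + k + 1 + j)))
    ≡ + (((n + p + q + k + 1) C (n + k)) ℕ.* T (n + k) k)
stirling-identity {T} rec d c-affine n p q k n≤p = begin
  sumTo p (λ j → sgn j ℤ.* + (C₁ j ℕ.* C₂ j ℕ.* C₃ j ℕ.* T (n + q + k + 1 + j) (q + k + 1 + j)))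
    ≡⟨ sumTo-cong p (λ j _ → cong (sgn j ℤ.*_) (summand-on-diagonal j)) ⟩
  sumTo p (λ j → sgn j ℤ.* (+ C₁ j ℤ.* + C₂ j ℤ.* + C₃ j ℤ.* diagonal T n (n + (q + k + 1 + j))))
    ≡⟨ polynomial-identity n p q k (diagonal T n) n≤p (diagonal-< T n) (diagonal-Deg< d c-affine n) ⟩
  + ((n + p + q + k + 1) C (n + k)) ℤ.* diagonal T n (n + k)
    ≡⟨ cong (+ ((n + p + q + k + 1) C (n + k)) ℤ.*_) (diagonal-+ T n k) ⟩
  + ((n + p + q + k + 1) C (n + k)) ℤ.* + T (n + k) k
    ≡⟨ ℤP.pos-* ((n + p + q + k + 1) C (n + k)) (T (n + k) k) ⟨
  + (((n + p + q + k + 1) C (n + k)) ℕ.* T (n + k) k) ∎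
  where
  open ≡-Reasoning
  open StirlingRecurrence rec
  C₁ C₂ C₃ : ℕ → ℕ
  C₁ j = (n + p + q + k + 1) C (p ∸ j)
  C₂ j = (q + j) C j
  C₃ j = (q + k + 1 + j) C k
  pos-*₄ : ∀ a b c e → + (a ℕ.* b ℕ.* c ℕ.* e) ≡ + a ℤ.* + b ℤ.* + c ℤ.* + e
  pos-*₄ a b c e = trans (ℤP.pos-* (a ℕ.* b ℕ.* c) e)
    (cong (ℤ._* + e) (trans (ℤP.pos-* (a ℕ.* b) c) (cong (ℤ._* + c) (ℤP.pos-* a b))))
  reassociate : ∀ n q k j → n + (q + k + 1 + j) ≡ n + q + k + 1 + j
  reassociate = ℕSolver.solve-∀
  summand-on-diagonal : ∀ j → + (C₁ j ℕ.* C₂ j ℕ.* C₃ j ℕ.* T (n + q + k + 1 + j) (q + k + 1 + j))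
                              ≡ + C₁ j ℤ.* + C₂ j ℤ.* + C₃ j ℤ.* diagonal T n (n + (q + k + 1 + j))
  summand-on-diagonal j = begin
    + (C₁ j ℕ.* C₂ j ℕ.* C₃ j ℕ.* T (n + q + k + 1 + j) (q + k + 1 + j))
      ≡⟨ pos-*₄ (C₁ j) (C₂ j) (C₃ j) (T (n + q + k + 1 + j) (q + k + 1 + j)) ⟩
    + C₁ j ℤ.* + C₂ j ℤ.* + C₃ j ℤ.* + T (n + q + k + 1 + j) (q + k + 1 + j)
      ≡⟨ cong (λ x → + C₁ j ℤ.* + C₂ j ℤ.* + C₃ j ℤ.* + T x (q + k + 1 + j)) (reassociate n q k j) ⟨
    + C₁ j ℤ.* + C₂ j ℤ.* + C₃ j ℤ.* + T (n + (q + k + 1 + j)) (q + k + 1 + j)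
      ≡⟨ cong (+ C₁ j ℤ.* + C₂ j ℤ.* + C₃ j ℤ.*_) (diagonal-+ T n (q + k + 1 + j)) ⟨
    + C₁ j ℤ.* + C₂ j ℤ.* + C₃ j ℤ.* diagonal T n (n + (q + k + 1 + j)) ∎

corollary4 : (r n p q k : ℕ) → p ≥ n →
    (sumTo p (λ j → sgn j ℤ.* (+ (((n + p + q + k + 1) C (p ∸ j)) ℕ.* ((q + j) C j) ℕ.* ((q + k + 1 + j) C k) ℕ.* rStirling1 r (n + q + k + 1 + j) (q + k + 1 + j))))
      ≡ + (((n + p + q + k + 1) C (n + k)) ℕ.* rStirling1 r (n + k) k))
    × (sumTo p (λ j → sgn j ℤ.* (+ (((n + p + q + k + 1) C (p ∸ j)) ℕ.* ((q + j) C j) ℕ.* ((q + k + 1 + j) C k) ℕ.* rStirling2 r (n + q + k + 1 + j) (q + k + 1 + j))))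
      ≡ + (((n + p + q + k + 1) C (n + k)) ℕ.* rStirling2 r (n + k) k))
corollary4 r n p q k n≤p =
  stirling-identity (rStirling1-recurrence r) (λ _ → + r) (λ _ _ → refl) n p q k n≤p ,
  stirling-identity (rStirling2-recurrence r) (λ n → + r ℤ.- + n) second-kind-affine n p q k n≤p
  where
  second-kind-affine : ∀ n m → + (m + r) ≡ + (n + m) ℤ.+ (+ r ℤ.- + n)
  second-kind-affine n m =
    trans (cancel (+ n) (+ m) (+ r)) (cong (ℤ._+ (+ r ℤ.- + n)) (sym (ℤP.pos-+ n m)))
    where
    cancel : ∀ (n m r : ℤ) → m ℤ.+ r ≡ (n ℤ.+ m) ℤ.+ (r ℤ.- n)
    cancel = solve-∀
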